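{- Define the integer sequence $(x_k)_{k \ge 0}$ by $x_0 = 11427$, $x_1 = 2984191388685$ and $x_{k+2} = 261152656\, x_{k+1} - x_k$ for $k \ge 0$. (Each $x_k$ satisfies $x_k^2 - 7^3 y_k^2 = 2$ for a positive integer $y_k$, where $y_0 = 617$, $y_1 = 161131189369$ and $y_{k+2} = 261152656\, y_{k+1} - y_k$.) Suppose there are infinitely many $k$ such that $$\left\{\frac{x_k}{m^{3/2}}\right\} > \frac{2}{m^{3/2}}$$ holds for every squarefree positive integer $m \notin \{1, 7\}$. Then there are infinitely many positive integers $x$ for which the three integers $(x-2)^2$, $(x-1)^2$, $x^2 - 2$ are all powerful and are three consecutive terms of the increasing sequence of powerful numbers.
   Context: A positive integer $n$ is powerful if for every prime $p \mid n$ also $p^2 \mid n$. For a real number $\xi$, $\{\xi\}$ denotes its fractional part. "Consecutive terms of the sequence of powerful numbers" means there is no powerful number strictly between the first and second, nor strictly between the second and third. -}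

module Defs where

open import Data.Nat using (ℕ; zero; suc; _+_; _*_; _∸_; _^_; _≤_; _<_)
open import Data.Nat.Divisibility using (_∣_)
open import Data.Nat.Primality using (Prime)
open import Data.Product using (_×_; _,_; proj₁)
open import Relation.Nullary using (¬_)

Powerful : ℕ → Set
Powerful n = 0 < n × (∀ p → Prime p → p ∣ n → p ^ 2 ∣ n)

Squarefree : ℕ → Set
Squarefree m = 0 < m × (∀ p → Prime p → ¬ (p ^ 2 ∣ m))

-- pairs (x_k , x_{k+1}); x_0 = 11427, x_1 = 2984191388685,
-- x_{k+2} = 261152656 x_{k+1} - x_k  (the sequence is positive and increasing,
-- so truncated subtraction is exact subtraction here)
xpair : ℕ → ℕ × ℕ
xpair zero = 11427 , 2984191388685
xpair (suc k) with xpair k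
... | a , b = b , (261152656 * b ∸ a)

xseq : ℕ → ℕ
xseq k = proj₁ (xpair k)

-- q = ⌊ x / m^{3/2} ⌋  (for x ≥ 0, m ≥ 1):  q·m^{3/2} ≤ x < (q+1)·m^{3/2}
IsFloorDivM32 : ℕ → ℕ → ℕ → Set
IsFloorDivM32 x m q = (q ^ 2) * (m ^ 3) ≤ x ^ 2 × x ^ 2 < (suc q ^ 2) * (m ^ 3)

-- { x / m^{3/2} } > c / m^{3/2}, i.e. x - ⌊x/m^{3/2}⌋·m^{3/2} > c,
-- i.e. q·m^{3/2} < x - c  where q is the floor (requires x > c).
FracGt : ℕ → ℕ → ℕ → Set
FracGt x c m = ∀ q → IsFloorDivM32 x m q → c < x × (q ^ 2) * (m ^ 3) < (x ∸ c) ^ 2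

ConsecPowerful3 : ℕ → ℕ → ℕ → Set
ConsecPowerful3 a b c =
  Powerful a × Powerful b × Powerful c × a < b × b < c ×
  (∀ n → a < n → n < b → ¬ Powerful n) × (∀ n → b < n → n < c → ¬ Powerful n)

-- The pairs (x_k, y_k) are the solutions of x² − 343 y² = 2 obtained from (11427, 617) by repeated
-- multiplication with the unit α + β√343 of norm 1, which is why x_k obeys a recurrence with trace 2α.
-- For x² = 343 y² + 2 the numbers (x − 2)², (x − 1)² and x² − 2 = 7³ y² are powerful. Every powerful
-- number is u² t³ with t squarefree, so a powerful n strictly between (x − 2)² and x² − 2 other than
-- (x − 1)² is either a square, which is impossible; or 7³ u² with u < y, impossible since
-- 7³ (y − 1)² ≤ (x − 2)²; or u² t³ with t ∉ {1, 7}, where u ≤ ⌊x / t^{3/2}⌋ and the hypothesis on the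
-- fractional part of x / t^{3/2} says exactly that ⌊x / t^{3/2}⌋² t³ < (x − 2)².

module Submission where

open import Defs
open import Data.Nat
open import Data.Nat.Properties
open import Data.Nat.Divisibility
open import Data.Nat.Primality
open import Data.Nat.Primality.Factorisation using (factorise)
open import Data.Nat.GCD using (gcd; gcd[m,n]∣m; gcd[m,n]∣n; gcd-greatest)
open import Data.Nat.ListAction using (product)
open import Data.Nat.Induction using (<-rec)
open import Data.Nat.Solver using (module +-*-Solver)
open import Data.List using (_∷_)
open import Data.List.Relation.Unary.All using (_∷_)
open import Data.Product using (_×_; _,_; proj₁; proj₂; ∃; ∃₂)
open import Data.Sum using ([_,_]′)
open import Function using (_∘_; id)
open import Relation.Unary using (Decidable)
open import Relation.Nullary using (¬_; yes; no; contradiction)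
open import Relation.Nullary.Decidable using (_×-dec_)
open import Relation.Binary.PropositionalEquality

open +-*-Solver using (solve; _:+_; _:*_; _:^_; _:=_; con)

brahmagupta-composition : ∀ {D a b c} x y → a ^ 2 ≡ D * b ^ 2 + 1 → x ^ 2 ≡ D * y ^ 2 + c →
                          (a * x + D * b * y) ^ 2 ≡ D * (b * x + a * y) ^ 2 + c
brahmagupta-composition {D} {a} {b} {c} x y unit sol = +-cancelʳ-≡ E _ _ (begin
  T + E                          ≡⟨ +-assoc T (B * (Y + c)) ((B + 1) * Y) ⟨
  T + B * (Y + c) + (B + 1) * Y  ≡⟨ subst₂ (λ A X → T + B * X + A * Y ≡ U + A * X + B * Y)
                                           unit sol brahmagupta-identity ⟩
  U + (B + 1) * (Y + c) + B * Y  ≡⟨ regroup U B Y c ⟩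
  U + c + E                      ∎)
  where
  open ≡-Reasoning
  T = (a * x + D * b * y) ^ 2
  U = D * (b * x + a * y) ^ 2
  B = D * b ^ 2
  Y = D * y ^ 2
  E = B * (Y + c) + (B + 1) * Y
  -- (a² − D b²)(x² − D y²) = (a x + D b y)² − D (b x + a y)², with the negative terms moved across.
  brahmagupta-identity : T + B * x ^ 2 + a ^ 2 * Y ≡ U + a ^ 2 * x ^ 2 + B * Y
  brahmagupta-identity = solve 5 (λ D a b x y →
    (a :* x :+ D :* b :* y) :^ 2 :+ D :* b :^ 2 :* x :^ 2 :+ a :^ 2 :* (D :* y :^ 2) :=
    D :* (b :* x :+ a :* y) :^ 2 :+ a :^ 2 :* x :^ 2 :+ D :* b :^ 2 :* (D :* y :^ 2)) refl D a b x y
  regroup : ∀ U B Y c → U + (B + 1) * (Y + c) + B * Y ≡ U + c + (B * (Y + c) + (B + 1) * Y)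
  regroup = solve 4 (λ U B Y c →
    U :+ (B :+ con 1) :* (Y :+ c) :+ B :* Y := U :+ c :+ (B :* (Y :+ c) :+ (B :+ con 1) :* Y)) refl

composition-recurrence : ∀ {D a b} x y → a ^ 2 ≡ D * b ^ 2 + 1 →
                         a * (a * x + D * b * y) + D * b * (b * x + a * y) + x ≡ 2 * a * (a * x + D * b * y)
composition-recurrence {D} {a} {b} x y unit = begin
  a * (a * x + D * b * y) + D * b * (b * x + a * y) + x
    ≡⟨ expandˡ D a b x y ⟩
  (a ^ 2 + (D * b ^ 2 + 1)) * x + 2 * D * a * b * y
    ≡⟨ cong (λ A → (a ^ 2 + A) * x + 2 * D * a * b * y) unit ⟨
  (a ^ 2 + a ^ 2) * x + 2 * D * a * b * y
    ≡⟨ expandʳ D a b x y ⟩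
  2 * a * (a * x + D * b * y)
    ∎
  where
  open ≡-Reasoning
  expandˡ : ∀ D a b x y → a * (a * x + D * b * y) + D * b * (b * x + a * y) + x ≡
                          (a ^ 2 + (D * b ^ 2 + 1)) * x + 2 * D * a * b * y
  expandˡ = solve 5 (λ D a b x y →
    a :* (a :* x :+ D :* b :* y) :+ D :* b :* (b :* x :+ a :* y) :+ x :=
    (a :^ 2 :+ (D :* b :^ 2 :+ con 1)) :* x :+ con 2 :* D :* a :* b :* y) refl
  expandʳ : ∀ D a b x y → (a ^ 2 + a ^ 2) * x + 2 * D * a * b * y ≡ 2 * a * (a * x + D * b * y)
  expandʳ = solve 5 (λ D a b x y →
    (a :^ 2 :+ a :^ 2) :* x :+ con 2 :* D :* a :* b :* y := con 2 :* a :* (a :* x :+ D :* b :* y)) refl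

-- Opaque, because unification would otherwise unfold α * n into α nested additions.
opaque
  α β : ℕ
  α = 130576328
  β = 7050459

  α²≡343β²+1 : α ^ 2 ≡ 343 * β ^ 2 + 1
  α²≡343β²+1 = refl

  2α≡261152656 : 2 * α ≡ 261152656
  2α≡261152656 = refl

  α*11427+343*β*617≡2984191388685 : α * 11427 + 343 * β * 617 ≡ 2984191388685
  α*11427+343*β*617≡2984191388685 = refl

  2≤α : 2 ≤ α
  2≤α = s≤s (s≤s z≤n)

pellX pellY : ℕ → ℕ
pellX zero    = 11427
pellX (suc k) = α * pellX k + 343 * β * pellY k
pellY zero    = 617
pellY (suc k) = β * pellX k + α * pellY k

pell-equation : ∀ k → pellX k ^ 2 ≡ 343 * pellY k ^ 2 + 2
pell-equation zero    = refl
pell-equation (suc k) =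
  brahmagupta-composition {343} {α} {β} (pellX k) (pellY k) α²≡343β²+1 (pell-equation k)

pellX-recurrence : ∀ k → pellX (2 + k) + pellX k ≡ 261152656 * pellX (1 + k)
pellX-recurrence k = trans (composition-recurrence {343} {α} {β} (pellX k) (pellY k) α²≡343β²+1)
                           (cong (_* pellX (1 + k)) 2α≡261152656)

xpair≡pellX : ∀ k → xpair k ≡ (pellX k , pellX (1 + k))
xpair≡pellX zero    = cong (11427 ,_) (sym α*11427+343*β*617≡2984191388685)
xpair≡pellX (suc k) = xpair-step (xpair≡pellX k) (pellX-recurrence k)
  where
  xpair-step : ∀ {p a b c} → p ≡ (a , b) → c + a ≡ 261152656 * b →
               (proj₂ p , 261152656 * proj₂ p ∸ proj₁ p) ≡ (b , c)
  xpair-step {a = a} {b} {c} refl c+a≡ = cong (b ,_) (trans (cong (_∸ a) (sym c+a≡)) (m+n∸n≡m c a))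

xseq≡pellX : ∀ k → xseq k ≡ pellX k
xseq≡pellX k = cong proj₁ (xpair≡pellX k)

pellY-positive : ∀ k → 0 < pellY k
pellY-positive zero    = s≤s z≤n
pellY-positive (suc k) = ≤-trans (*-mono-≤ (≤-trans (s≤s z≤n) 2≤α) (pellY-positive k)) (m≤n+m _ _)

pellX-lower : ∀ k → 3 + k ≤ pellX k
pellX-lower zero    = s≤s (s≤s (s≤s z≤n))
pellX-lower (suc k) = begin
  suc (3 + k)        ≤⟨ s≤s (pellX-lower k) ⟩
  1 + pellX k        ≤⟨ +-monoˡ-≤ (pellX k) (≤-trans (s≤s z≤n) (pellX-lower k)) ⟩
  pellX k + pellX k  ≡⟨ cong (pellX k +_) (+-identityʳ (pellX k)) ⟨
  2 * pellX k        ≤⟨ *-monoˡ-≤ (pellX k) 2≤α ⟩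
  α * pellX k        ≤⟨ m≤m+n _ _ ⟩
  pellX (suc k)      ∎
  where open ≤-Reasoning

prime∣^⇒∣ : ∀ {p m} n → Prime p → p ∣ m ^ n → p ∣ m
prime∣^⇒∣ zero    pp p∣1 = contradiction (∣1⇒≡1 p∣1) λ { refl → ¬prime[1] pp }
prime∣^⇒∣ {m = m} (suc n) pp p∣m*mⁿ = [ id , prime∣^⇒∣ n pp ]′ (euclidsLemma m (m ^ n) pp p∣m*mⁿ)

∣m∣n⇒^2∣m*n : ∀ {p m n} → p ∣ m → p ∣ n → p ^ 2 ∣ m * n
∣m∣n⇒^2∣m*n {p} {m} {n} p∣m p∣n = subst (_∣ m * n) (cong (p *_) (sym (*-identityʳ p))) (*-pres-∣ p∣m p∣n)

powerful-^ : ∀ {n} k → 0 < n → Powerful (n ^ (2 + k))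
powerful-^ {n} k 0<n = m^n>0 n {{>-nonZero 0<n}} (2 + k) , λ p pp p∣nᵏ →
  let p∣n = prime∣^⇒∣ {m = n} (2 + k) pp p∣nᵏ in *-pres-∣ p∣n (*-pres-∣ p∣n (1∣ (n ^ k)))

powerful-* : ∀ {m n} → Powerful m → Powerful n → Powerful (m * n)
powerful-* {m} {n} (0<m , powm) (0<n , pown) = *-mono-< 0<m 0<n , λ p pp p∣mn →
  [ ∣m⇒∣m*n n ∘ powm p pp , ∣n⇒∣m*n m ∘ pown p pp ]′ (euclidsLemma m n pp p∣mn)

no-prime-divisor⇒≡1 : ∀ {n} → (∀ p → Prime p → ¬ p ∣ n) → n ≡ 1
no-prime-divisor⇒≡1 {zero}     ∄p = contradiction (2 ∣0) (∄p 2 prime[2])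
no-prime-divisor⇒≡1 {1}        ∄p = refl
no-prime-divisor⇒≡1 {n@(2+ _)} ∄p with factorise n
... | record { factors = p ∷ ps ; isFactorisation = n≡p*ps ; factorsPrime = pp ∷ _ } =
  contradiction (divides (product ps) (trans n≡p*ps (*-comm p _))) (∄p p pp)

-- Writing t = t′ · gcd t s, a prime factor of t′ would divide gcd t s as well, so p² ∣ t.
squarefree-∣ : ∀ {t s} → Squarefree t → (∀ p → Prime p → p ∣ t → p ∣ s) → t ∣ s
squarefree-∣ {t} {s} (_ , sf) primes∣s with gcd[m,n]∣m t s
... | divides t′ t≡t′g = subst (_∣ s) (sym t≡g) (gcd[m,n]∣n t s)
  where
  g = gcd t s
  t′≡1 : t′ ≡ 1
  t′≡1 = no-prime-divisor⇒≡1 λ p pp p∣t′ →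
    let p∣t = ∣-trans p∣t′ (divides g (trans t≡t′g (*-comm t′ g))) in
    sf p pp (subst (p ^ 2 ∣_) (sym t≡t′g) (∣m∣n⇒^2∣m*n p∣t′ (gcd-greatest p∣t (primes∣s p pp p∣t))))
  t≡g : t ≡ g
  t≡g = trans t≡t′g (trans (cong (_* g) t′≡1) (*-identityˡ g))

-- If p ∤ s, then p² ∣ s² t forces p² ∣ t.
powerful⇒prime∣root : ∀ {s t p} → Powerful (s ^ 2 * t) → Squarefree t → Prime p → p ∣ t → p ∣ s
powerful⇒prime∣root {s} {t} {p} (_ , pw) (_ , sf) pp p∣t@(divides r t≡rp) with p ∣? s
... | yes p∣s = p∣s
... | no  p∤s = contradiction (subst (p ^ 2 ∣_) (sym t≡rp) (∣m∣n⇒^2∣m*n p∣r ∣-refl)) (sf p pp)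
  where
  p∣s²r : p ∣ s ^ 2 * r
  p∣s²r = *-cancelʳ-∣ p {{prime⇒nonZero pp}}
    (subst₂ _∣_ (cong (p *_) (*-identityʳ p)) (trans (cong (s ^ 2 *_) t≡rp) (sym (*-assoc (s ^ 2) r p)))
      (pw p pp (∣n⇒∣m*n (s ^ 2) p∣t)))
  p∣r : p ∣ r
  p∣r = [ (λ p∣s² → contradiction (prime∣^⇒∣ 2 pp p∣s²) p∤s) , id ]′ (euclidsLemma (s ^ 2) r pp p∣s²r)

squarefree-decomposition : ∀ n → 0 < n → ∃₂ λ s t → n ≡ s ^ 2 * t × Squarefree t
squarefree-decomposition = <-rec _ decompose
  where
  decompose : ∀ n → (∀ {q} → q < n → 0 < q → ∃₂ λ s t → q ≡ s ^ 2 * t × Squarefree t) →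
              0 < n → ∃₂ λ s t → n ≡ s ^ 2 * t × Squarefree t
  decompose n rec 0<n with anyUpTo? (λ p → prime? p ×-dec p ^ 2 ∣? n) (suc n)
  ... | no ∄p = 1 , n , sym (+-identityʳ n) , 0<n , λ p pp p²∣n →
    ∄p (p , s≤s (∣⇒≤ {{>-nonZero 0<n}} (∣-trans (m∣m*n (p * 1)) p²∣n)) , pp , p²∣n)
  ... | yes (_ , _ , _  , divides zero n≡0) = contradiction n≡0 (>⇒≢ 0<n)
  ... | yes (p , _ , pp , divides q@(suc _) n≡qp²) with rec q<n (s≤s z≤n)
    where
    q<n : q < n
    q<n = subst (q <_) (sym n≡qp²)
            (m<m*n q (p ^ 2) (^-monoˡ-< 2 (nonTrivial⇒n>1 p {{prime⇒nonTrivial pp}})))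
  ... | s , t , q≡s²t , sf = s * p , t , trans n≡qp² (trans (cong (_* p ^ 2) q≡s²t) (regroup s t p)) , sf
    where
    regroup : ∀ s t p → s ^ 2 * t * p ^ 2 ≡ (s * p) ^ 2 * t
    regroup = solve 3 (λ s t p → s :^ 2 :* t :* p :^ 2 := (s :* p) :^ 2 :* t) refl

-- Opaque, because with-abstraction over this lemma would otherwise normalise the whole proof term.
opaque
  powerful-decomposition : ∀ {n} → Powerful n → ∃₂ λ u t → n ≡ u ^ 2 * t ^ 3 × Squarefree t
  powerful-decomposition {n} pw with squarefree-decomposition n (proj₁ pw)
  ... | s , t , n≡s²t , sf
    with squarefree-∣ sf (λ p pp → powerful⇒prime∣root {s = s} (subst Powerful n≡s²t pw) sf pp)
  ... | divides u s≡ut = u , t , trans n≡s²t (trans (cong (λ s → s ^ 2 * t) s≡ut) (regroup u t)) , sf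
    where
    regroup : ∀ u t → (u * t) ^ 2 * t ≡ u ^ 2 * t ^ 3
    regroup = solve 2 (λ u t → (u :* t) :^ 2 :* t := u :^ 2 :* t :^ 3) refl

^-cancelˡ-< : ∀ n {a b} → a ^ n < b ^ n → a < b
^-cancelˡ-< n aⁿ<bⁿ = ≰⇒> λ b≤a → <⇒≱ aⁿ<bⁿ (^-monoˡ-≤ n b≤a)

^-cancelˡ-≤ : ∀ n .{{_ : NonZero n}} {a b} → a ^ n ≤ b ^ n → a ≤ b
^-cancelˡ-≤ n aⁿ≤bⁿ = ≮⇒≥ λ b<a → <⇒≱ (^-monoˡ-< n b<a) aⁿ≤bⁿ

∃-transition : ∀ {P : ℕ → Set} → Decidable P → P 0 → ∀ {n} → ¬ P n → ∃ λ q → P q × ¬ P (suc q)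
∃-transition P? P0 {zero}  ¬P0  = contradiction P0 ¬P0
∃-transition P? P0 {suc n} ¬Psn with P? n
... | yes Pn  = n , Pn , ¬Psn
... | no  ¬Pn = ∃-transition P? P0 ¬Pn

∃-floorDivM32 : ∀ x {m} → 0 < m → ∃ (IsFloorDivM32 x m)
∃-floorDivM32 x {m} 0<m with ∃-transition (λ q → q ^ 2 * m ^ 3 ≤? x ^ 2) z≤n {suc x} too-big
  where
  too-big : ¬ suc x ^ 2 * m ^ 3 ≤ x ^ 2
  too-big le = <⇒≱ (^-monoˡ-< 2 (n<1+n x))
                   (≤-trans (m≤m*n (suc x ^ 2) (m ^ 3) {{m^n≢0 m 3 {{>-nonZero 0<m}}}}) le)
... | q , lower , ¬upper = q , lower , ≰⇒> ¬upper

floorDivM32-maximal : ∀ {x m q u} → IsFloorDivM32 x m q → u ^ 2 * m ^ 3 ≤ x ^ 2 → u ≤ q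
floorDivM32-maximal {m = m} (_ , x²<[1+q]²m³) u²m³≤x² =
  ≤-pred (^-cancelˡ-< 2 (*-cancelʳ-< (m ^ 3) _ _ (≤-<-trans u²m³≤x² x²<[1+q]²m³)))

fracGt⇒u²m³<[x∸c]² : ∀ {x c m u} → FracGt x c m → 0 < m →
                      u ^ 2 * m ^ 3 ≤ x ^ 2 → u ^ 2 * m ^ 3 < (x ∸ c) ^ 2
fracGt⇒u²m³<[x∸c]² {x} {m = m} {u} frac 0<m u²m³≤x² with ∃-floorDivM32 x 0<m
... | q , isFloor = ≤-<-trans (*-monoˡ-≤ (m ^ 3) (^-monoˡ-≤ 2 u≤q)) (proj₂ (frac q isFloor))
  where
  u≤q : u ≤ q
  u≤q = floorDivM32-maximal {x} {m} {q} {u} isFloor u²m³≤x²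

FracCondition : ℕ → Set
FracCondition x = ∀ m → Squarefree m → m ≢ 1 → m ≢ 7 → FracGt x 2 m

square-between : ∀ {z u} → z ^ 2 < u ^ 2 → u ^ 2 < (2 + z) ^ 2 → u ≡ 1 + z
square-between z²<u² u²<[2+z]² = ≤-antisym (≤-pred (^-cancelˡ-< 2 u²<[2+z]²)) (^-cancelˡ-< 2 z²<u²)

no-powerful-in-gap : ∀ {z c n} → FracCondition (2 + z) → c ≤ (2 + z) ^ 2 →
                     (∀ {u} → u ^ 2 * 7 ^ 3 < c → u ^ 2 * 7 ^ 3 ≤ z ^ 2) →
                     z ^ 2 < n → n < c → n ≢ (1 + z) ^ 2 → ¬ Powerful n
no-powerful-in-gap {z} {c} {n} frac c≤x² sevens z²<n n<c n≢[1+z]² pw with powerful-decomposition pw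
... | u , t , n≡u²t³ , sf with t ≟ 1 | t ≟ 7
... | yes refl | _ = n≢[1+z]² (trans n≡u² (cong (_^ 2) u≡1+z))
  where
  n≡u² : n ≡ u ^ 2
  n≡u² = trans n≡u²t³ (*-identityʳ (u ^ 2))
  u≡1+z : u ≡ 1 + z
  u≡1+z = square-between (subst (z ^ 2 <_) n≡u² z²<n) (subst (_< (2 + z) ^ 2) n≡u² (<-≤-trans n<c c≤x²))
... | no _ | yes refl = <⇒≱ z²<n (subst (_≤ z ^ 2) (sym n≡u²t³) (sevens {u} (subst (_< c) n≡u²t³ n<c)))
... | no t≢1 | no t≢7 = <⇒≱ z²<n (subst (_≤ z ^ 2) (sym n≡u²t³) (<⇒≤ u²t³<z²))
  where
  u²t³≤x² : u ^ 2 * t ^ 3 ≤ (2 + z) ^ 2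
  u²t³≤x² = subst (_≤ (2 + z) ^ 2) n≡u²t³ (<⇒≤ (<-≤-trans n<c c≤x²))
  u²t³<z² : u ^ 2 * t ^ 3 < z ^ 2
  u²t³<z² = fracGt⇒u²m³<[x∸c]² {2 + z} {2} {t} {u} (frac t sf t≢1 t≢7) (proj₁ sf) u²t³≤x²

-- √343 < 19 bounds x = 2 + z linearly by y = 1 + w, and that bound controls the cross term of (2 + z)².
pell⇒343w²≤z² : ∀ {z w} → (2 + z) ^ 2 ≡ 343 * (1 + w) ^ 2 + 2 → 343 * w ^ 2 ≤ z ^ 2
pell⇒343w²≤z² {z} {w} pell = m+n≤o⇒m≤o (343 * w ^ 2) (+-cancelʳ-≤ (4 * (19 * w + 17) + 4) _ _ (begin
  343 * w ^ 2 + (610 * w + 273) + (4 * (19 * w + 17) + 4)  ≡⟨ expand-y w ⟩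
  343 * (1 + w) ^ 2 + 2                                      ≡⟨ pell ⟨
  (2 + z) ^ 2                                                ≡⟨ expand-x z ⟩
  z ^ 2 + (4 * z + 4)                                        ≤⟨ +-monoʳ-≤ (z ^ 2) (+-monoˡ-≤ 4 4z≤4[19w+17]) ⟩
  z ^ 2 + (4 * (19 * w + 17) + 4)                            ∎))
  where
  open ≤-Reasoning
  343y²+18y²≡[19y]² : ∀ y → 343 * y ^ 2 + 18 * y ^ 2 ≡ (19 * y) ^ 2
  343y²+18y²≡[19y]² = solve 1 (λ y → con 343 :* y :^ 2 :+ con 18 :* y :^ 2 := (con 19 :* y) :^ 2) refl
  2≤18y² : 2 ≤ 18 * (1 + w) ^ 2
  2≤18y² = ≤-trans (s≤s (s≤s z≤n)) (*-monoʳ-≤ 18 (m^n>0 (1 + w) 2))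
  x≤19y : 2 + z ≤ 19 * (1 + w)
  x≤19y = ^-cancelˡ-≤ 2 (begin
    (2 + z) ^ 2                           ≡⟨ pell ⟩
    343 * (1 + w) ^ 2 + 2                 ≤⟨ +-monoʳ-≤ (343 * (1 + w) ^ 2) 2≤18y² ⟩
    343 * (1 + w) ^ 2 + 18 * (1 + w) ^ 2  ≡⟨ 343y²+18y²≡[19y]² (1 + w) ⟩
    (19 * (1 + w)) ^ 2                    ∎)
  19[1+w]≡2+[19w+17] : ∀ w → 19 * (1 + w) ≡ 2 + (19 * w + 17)
  19[1+w]≡2+[19w+17] = solve 1 (λ w → con 19 :* (con 1 :+ w) := con 2 :+ (con 19 :* w :+ con 17)) refl
  4z≤4[19w+17] : 4 * z ≤ 4 * (19 * w + 17)
  4z≤4[19w+17] = *-monoʳ-≤ 4 (≤-pred (≤-pred (subst (2 + z ≤_) (19[1+w]≡2+[19w+17] w) x≤19y)))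
  expand-y : ∀ w → 343 * w ^ 2 + (610 * w + 273) + (4 * (19 * w + 17) + 4) ≡ 343 * (1 + w) ^ 2 + 2
  expand-y = solve 1 (λ w →
    con 343 :* w :^ 2 :+ (con 610 :* w :+ con 273) :+ (con 4 :* (con 19 :* w :+ con 17) :+ con 4) :=
    con 343 :* (con 1 :+ w) :^ 2 :+ con 2) refl
  expand-x : ∀ z → (2 + z) ^ 2 ≡ z ^ 2 + (4 * z + 4)
  expand-x = solve 1 (λ z → (con 2 :+ z) :^ 2 := z :^ 2 :+ (con 4 :* z :+ con 4)) refl

pell⇒u²7³≤z² : ∀ {z w u} → (2 + z) ^ 2 ≡ 343 * (1 + w) ^ 2 + 2 →
               u ^ 2 * 7 ^ 3 < 343 * (1 + w) ^ 2 → u ^ 2 * 7 ^ 3 ≤ z ^ 2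
pell⇒u²7³≤z² {z} {w} {u} pell u²7³<343y² = begin
  u ^ 2 * 343  ≡⟨ *-comm (u ^ 2) 343 ⟩
  343 * u ^ 2  ≤⟨ *-monoʳ-≤ 343 (^-monoˡ-≤ 2 u≤w) ⟩
  343 * w ^ 2  ≤⟨ pell⇒343w²≤z² {z} {w} pell ⟩
  z ^ 2        ∎
  where
  open ≤-Reasoning
  u≤w : u ≤ w
  u≤w = ≤-pred (^-cancelˡ-< 2 (*-cancelˡ-< 343 (u ^ 2) ((1 + w) ^ 2)
          (subst (_< 343 * (1 + w) ^ 2) (*-comm (u ^ 2) 343) u²7³<343y²)))

pell⇒consecutivePowerful : ∀ {x y} → 3 ≤ x → 0 < y → x ^ 2 ≡ 343 * y ^ 2 + 2 → FracCondition x →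
                           ConsecPowerful3 ((x ∸ 2) ^ 2) ((x ∸ 1) ^ 2) (x ^ 2 ∸ 2)
pell⇒consecutivePowerful {suc (suc z)} {suc w} (s≤s (s≤s 1≤z)) (s≤s z≤n) pell frac =
  subst (ConsecPowerful3 (z ^ 2) ((1 + z) ^ 2)) (sym (trans (cong (_∸ 2) pell) (m+n∸n≡m _ 2)))
    ( powerful-^ 0 1≤z
    , powerful-^ {1 + z} 0 (s≤s z≤n)
    , powerful-* (powerful-^ {7} 1 (s≤s z≤n)) (powerful-^ {1 + w} 0 (s≤s z≤n))
    , z²<[1+z]²
    , [1+z]²<343y²
    , (λ n z²<n n<[1+z]² → gap z²<n (<-trans n<[1+z]² [1+z]²<343y²) (<⇒≢ n<[1+z]²))
    , (λ n [1+z]²<n n<343y² → gap (<-trans z²<[1+z]² [1+z]²<n) n<343y² (>⇒≢ [1+z]²<n)))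
  where
  z²<[1+z]² : z ^ 2 < (1 + z) ^ 2
  z²<[1+z]² = ^-monoˡ-< 2 (n<1+n z)
  expand : ∀ z → (1 + z) ^ 2 + (1 + 2 * z) + 2 ≡ (2 + z) ^ 2
  expand = solve 1 (λ z → (con 1 :+ z) :^ 2 :+ (con 1 :+ con 2 :* z) :+ con 2 := (con 2 :+ z) :^ 2) refl
  [1+z]²<343y² : (1 + z) ^ 2 < 343 * (1 + w) ^ 2
  [1+z]²<343y² = <-≤-trans (m<m+n _ (s≤s z≤n)) (≤-reflexive (+-cancelʳ-≡ 2 _ _ (trans (expand z) pell)))
  gap : ∀ {n} → z ^ 2 < n → n < 343 * (1 + w) ^ 2 → n ≢ (1 + z) ^ 2 → ¬ Powerful n
  gap {n} = no-powerful-in-gap {z} {343 * (1 + w) ^ 2} {n} frac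
              (≤-trans (m≤m+n _ 2) (≤-reflexive (sym pell))) (λ {u} → pell⇒u²7³≤z² {z} {w} {u} pell)

mainTheorem2 : (∀ N → ∃ λ k → N ≤ k ×
                  (∀ m → Squarefree m → m ≢ 1 → m ≢ 7 → FracGt (xseq k) 2 m)) →
               ∀ N → ∃ λ x → N < x ×
                  ConsecPowerful3 ((x ∸ 2) ^ 2) ((x ∸ 1) ^ 2) (x ^ 2 ∸ 2)
mainTheorem2 hypothesis N with hypothesis N
... | k , N≤k , frac = pellX k , N<xₖ ,
  pell⇒consecutivePowerful 3≤xₖ (pellY-positive k) (pell-equation k)
                           (subst FracCondition (xseq≡pellX k) frac)
  where
  3≤xₖ : 3 ≤ pellX k
  3≤xₖ = ≤-trans (m≤m+n 3 k) (pellX-lower k)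
  N<xₖ : N < pellX k
  N<xₖ = ≤-trans (s≤s (≤-trans N≤k (m≤n+m k 2))) (pellX-lower k)
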